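{- Let $t \geq 1$ and $k \geq 1$ be integers, and let $C_n = \frac{1}{n+1}\binom{2n}{n}$ denote the $n$-th Catalan number. Then $$\#\{n \in \mathbb{Z}_{>0} : n < 2^t,\ C_n \equiv 0 \pmod{2^k}\} = \sum_{i=k+1}^{t} \binom{t}{i}.$$
   Context: $C_n = \frac{1}{n+1}\binom{2n}{n}$ is the $n$-th Catalan number. -}

module Defs where

open import Data.Nat using (ℕ; zero; suc; _+_; _*_; _^_; _≤?_)
open import Data.Nat.Divisibility using (_∣_; _∣?_)
open import Data.Nat.DivMod using (_/_)
open import Data.Nat.Combinatorics using (_C_)
open import Data.List using (List; filter; length; map; upTo; drop)
open import Data.Nat.ListAction using (sum)
open import Relation.Nullary.Decidable using (_×-dec_)

-- n-th Catalan number C_n = (1/(n+1)) * binom(2n, n)  (exact division in ℕ)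
catalan : ℕ → ℕ
catalan n = ((2 * n) C n) / suc n

countCatalanDiv : ℕ → ℕ → ℕ
countCatalanDiv t k =
  length (filter (λ n → (1 ≤? n) ×-dec ((2 ^ k) ∣? catalan n)) (upTo (2 ^ t)))

binomTailSum : ℕ → ℕ → ℕ
binomTailSum t k = sum (map (λ i → t C i) (drop (suc k) (upTo (suc t))))

-- Legendre's formula ν₂(m!) = m − s(m), with s = popcount the binary digit sum, gives
-- ν₂(C_n) = ν₂((2n)!) − ν₂((n+1)!) − ν₂(n!) = s(n+1) − 1, so for k ≥ 1 we are counting
-- the m = n + 1 ∈ [2, 2^t] with s(m) > k; since s(1) = s(2^t) = 1 ≤ k these are the m < 2^t
-- with s(m) > k. Splitting m < 2^(t+1) into 2m and 2m + 1 shows that the number of m < 2^t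
-- with s(m) ≥ j obeys Pascal's rule in (t, j), hence equals Σ_{i ≥ j} C(t, i).
module Submission where

open import Data.Bool using (Bool; true; false)
open import Data.Empty using (⊥-elim)
open import Data.List using (List; []; _∷_; filter; length; map; drop; applyUpTo)
open import Data.Nat
  using (ℕ; zero; suc; _+_; _*_; _^_; _∸_; _!; _≤_; _<_; _≥_; _≤ᵇ_; _≤?_; z≤n; s≤s; z<s; NonZero)
open import Data.Nat.Binary.Base as ℕᵇ using (2[1+_]; 1+[2_])
open import Data.Nat.Binary.Properties as ℕᵇ using ()
open import Data.Nat.Combinatorics
  using (_C_; nCk≡n!/k![n-k]!; k![n∸k]!∣n!; [n-k]*[n-k-1]!≡[n-k]!; nCk+nC[k+1]≡[n+1]C[k+1]; k>n⇒nCk≡0)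
open import Data.Nat.Divisibility using (_∣_; _∣?_; divides; 1∣_; m∣m*n; ∣-trans; ∣m+n∣m⇒∣n; *-cancelˡ-∣)
open import Data.Nat.DivMod using (m/n*n≡m)
open import Data.Nat.Induction using (<-rec)
open import Data.Nat.ListAction using (sum)
open import Data.Nat.Properties
open import Algebra.Properties.CommutativeSemigroup +-commutativeSemigroup using (interchange)
open import Data.Nat.Tactic.RingSolver using (solve-∀)
open import Data.Product using (∃; _,_; _×_)
open import Function using (_∘_; id; _⇔_; mk⇔)
open import Relation.Binary.PropositionalEquality
open import Relation.Nullary using (¬_; does)
open import Relation.Nullary.Decidable using (_×-dec_; does-⇔)
open import Relation.Unary using (Decidable)

open import Defs

halving-induction : ∀ {ℓ} (P : ℕ → Set ℓ) → P 0 →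
                    (∀ h → P h → P (1 + 2 * h)) →
                    (∀ h → P (suc h) → P (2 * suc h)) →
                    ∀ n → P n
halving-induction P P0 Podd Peven = <-rec P step
  where
  step : ∀ n → (∀ {m} → m < n → P m) → P n
  step n rec with ℕᵇ.fromℕ n | ℕᵇ.toℕ-fromℕ n
  ... | ℕᵇ.zero | refl = P0
  ... | 1+[2 x ] | refl = Podd (ℕᵇ.toℕ x) (rec (s≤s (m≤m+n _ _)))
  ... | 2[1+ x ] | refl = Peven (ℕᵇ.toℕ x) (rec (m<m+n (suc (ℕᵇ.toℕ x)) z<s))

Odd : ℕ → Set
Odd u = ∃ λ h → u ≡ 1 + 2 * h

odd-* : ∀ {a b} → Odd a → Odd b → Odd (a * b)
odd-* (x , refl) (y , refl) = x + y + 2 * x * y , lemma x y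
  where
  lemma : ∀ x y → (1 + 2 * x) * (1 + 2 * y) ≡ 1 + 2 * (x + y + 2 * x * y)
  lemma = solve-∀

odd⇒¬2∣ : ∀ {u} → Odd u → ¬ 2 ∣ u
odd⇒¬2∣ (h , refl) (divides q eq) = even≢odd q h (trans (*-comm 2 q) (sym eq))

infix 4 2^_∥_

record 2^_∥_ (v n : ℕ) : Set where
  constructor mk∥
  field
    oddPart     : ℕ
    oddPart-odd : Odd oddPart
    factorise   : n ≡ 2 ^ v * oddPart

∥-* : ∀ {v w a b} → 2^ v ∥ a → 2^ w ∥ b → 2^ (v + w) ∥ a * b
∥-* {v} {w} (mk∥ u odd-u refl) (mk∥ u′ odd-u′ refl) = mk∥ (u * u′) (odd-* odd-u odd-u′)
  (trans (lemma (2 ^ v) (2 ^ w) u u′) (cong (_* (u * u′)) (sym (^-distribˡ-+-* 2 v w))))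
  where
  lemma : ∀ p q u u′ → p * u * (q * u′) ≡ p * q * (u * u′)
  lemma = solve-∀

∥⇒∣ : ∀ {v n k} → 2^ v ∥ n → k ≤ v → 2 ^ k ∣ n
∥⇒∣ {v} {k = k} (mk∥ u _ refl) k≤v =
  subst (λ x → 2 ^ k ∣ x * u) 2^k*2^[v∸k]≡2^v (∣-trans (m∣m*n (2 ^ (v ∸ k))) (m∣m*n u))
  where
  2^k*2^[v∸k]≡2^v : 2 ^ k * 2 ^ (v ∸ k) ≡ 2 ^ v
  2^k*2^[v∸k]≡2^v = trans (sym (^-distribˡ-+-* 2 k (v ∸ k))) (cong (2 ^_) (m+[n∸m]≡n k≤v))

∥-∣⇒≤ : ∀ {v n k} → 2^ v ∥ n → 2 ^ k ∣ n → k ≤ v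
∥-∣⇒≤ {k = zero} _ _ = z≤n
∥-∣⇒≤ {zero} {k = suc k} (mk∥ u odd-u refl) 2^k∣u =
  ⊥-elim (odd⇒¬2∣ odd-u (∣-trans (m∣m*n (2 ^ k)) (subst (2 ^ suc k ∣_) (*-identityˡ u) 2^k∣u)))
∥-∣⇒≤ {suc v} {k = suc k} (mk∥ u odd-u refl) 2^k∣n =
  s≤s (∥-∣⇒≤ (mk∥ u odd-u refl) (*-cancelˡ-∣ 2 (subst (2 ^ suc k ∣_) (*-assoc 2 (2 ^ v) u) 2^k∣n)))

∥-unique : ∀ {v w n} → 2^ v ∥ n → 2^ w ∥ n → v ≡ w
∥-unique ∥v ∥w = ≤-antisym (∥-∣⇒≤ ∥w (∥⇒∣ ∥v ≤-refl)) (∥-∣⇒≤ ∥v (∥⇒∣ ∥w ≤-refl))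

odd⇒2^0∥ : ∀ {u} → Odd u → 2^ 0 ∥ u
odd⇒2^0∥ {u} odd-u = mk∥ u odd-u (sym (*-identityˡ u))

2^1∥2 : 2^ 1 ∥ 2
2^1∥2 = mk∥ 1 (0 , refl) refl

∥-exists : ∀ n → .{{NonZero n}} → ∃ λ v → 2^ v ∥ n
∥-exists = halving-induction (λ n → .{{NonZero n}} → ∃ λ v → 2^ v ∥ n)
  (λ { {{()}} })
  (λ h _ → 0 , odd⇒2^0∥ (h , refl))
  (λ h ∃∥ → let v , ∥v = ∃∥ in suc v , ∥-* 2^1∥2 ∥v)

-- Little-endian binary digits.
inc : List Bool → List Bool
inc []           = true ∷ []
inc (false ∷ bs) = true ∷ bs
inc (true ∷ bs)  = false ∷ inc bs

bits : ℕ → List Bool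
bits zero    = []
bits (suc n) = inc (bits n)

shift : List Bool → List Bool
shift []       = []
shift (b ∷ bs) = false ∷ b ∷ bs

ones : List Bool → ℕ
ones []           = 0
ones (false ∷ bs) = ones bs
ones (true ∷ bs)  = suc (ones bs)

popcount : ℕ → ℕ
popcount n = ones (bits n)

inc-inc-shift : ∀ bs → inc (inc (shift bs)) ≡ shift (inc bs)
inc-inc-shift []          = refl
inc-inc-shift (false ∷ _) = refl
inc-inc-shift (true ∷ _)  = refl

inc-shift : ∀ bs → inc (shift bs) ≡ true ∷ bs
inc-shift []      = refl
inc-shift (_ ∷ _) = refl

ones-shift : ∀ bs → ones (shift bs) ≡ ones bs
ones-shift []      = refl
ones-shift (_ ∷ _) = refl

bits-2* : ∀ n → bits (2 * n) ≡ shift (bits n)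
bits-2* zero    = refl
bits-2* (suc n) = begin
  bits (2 * suc n)             ≡⟨ cong bits (*-suc 2 n) ⟩
  inc (inc (bits (2 * n)))     ≡⟨ cong (inc ∘ inc) (bits-2* n) ⟩
  inc (inc (shift (bits n)))   ≡⟨ inc-inc-shift (bits n) ⟩
  shift (bits (suc n))         ∎
  where open ≡-Reasoning

popcount-2* : ∀ n → popcount (2 * n) ≡ popcount n
popcount-2* n = trans (cong ones (bits-2* n)) (ones-shift (bits n))

popcount-1+2* : ∀ n → popcount (1 + 2 * n) ≡ suc (popcount n)
popcount-1+2* n = cong ones (trans (cong inc (bits-2* n)) (inc-shift (bits n)))

popcount-2^ : ∀ t → popcount (2 ^ t) ≡ 1
popcount-2^ zero    = refl
popcount-2^ (suc t) = trans (popcount-2* (2 ^ t)) (popcount-2^ t)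

-- Incrementing m turns its v trailing ones into zeros and one zero into a one.
suc-∥-popcount : ∀ m → ∃ λ v → 2^ v ∥ suc m × popcount (suc m) + v ≡ suc (popcount m)
suc-∥-popcount = halving-induction P (0 , odd⇒2^0∥ (0 , refl) , refl) odd-case even-case
  where
  P : ℕ → Set
  P m = ∃ λ v → 2^ v ∥ suc m × popcount (suc m) + v ≡ suc (popcount m)

  odd-case : ∀ h → P h → P (1 + 2 * h)
  odd-case h (v , ∥v , carry) =
    suc v , subst (2^ suc v ∥_) (*-suc 2 h) (∥-* 2^1∥2 ∥v) , (begin
      popcount (2 + 2 * h) + suc v ≡⟨ cong (λ x → popcount x + suc v) (*-suc 2 h) ⟨
      popcount (2 * suc h) + suc v ≡⟨ cong (_+ suc v) (popcount-2* (suc h)) ⟩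
      popcount (suc h) + suc v     ≡⟨ +-suc (popcount (suc h)) v ⟩
      suc (popcount (suc h) + v)   ≡⟨ cong suc carry ⟩
      suc (suc (popcount h))       ≡⟨ cong suc (popcount-1+2* h) ⟨
      suc (popcount (1 + 2 * h))   ∎)
    where open ≡-Reasoning

  even-case : ∀ h → P (suc h) → P (2 * suc h)
  even-case h _ = 0 , odd⇒2^0∥ (suc h , refl) , (begin
    popcount (1 + 2 * suc h) + 0 ≡⟨ +-identityʳ _ ⟩
    popcount (1 + 2 * suc h)     ≡⟨ popcount-1+2* (suc h) ⟩
    suc (popcount (suc h))       ≡⟨ cong suc (popcount-2* (suc h)) ⟨
    suc (popcount (2 * suc h))   ∎)
    where open ≡-Reasoning

factorial-∥ : ∀ m → ∃ λ v → 2^ v ∥ m ! × v + popcount m ≡ m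
factorial-∥ zero = 0 , odd⇒2^0∥ (0 , refl) , refl
factorial-∥ (suc m) with suc-∥-popcount m | factorial-∥ m
... | w , ∥w , carry | v , ∥v , legendre = w + v , ∥-* ∥w ∥v , (begin
  w + v + popcount (suc m)   ≡⟨ lemma w v (popcount (suc m)) ⟩
  v + (popcount (suc m) + w) ≡⟨ cong (v +_) carry ⟩
  v + suc (popcount m)       ≡⟨ +-suc v (popcount m) ⟩
  suc (v + popcount m)       ≡⟨ cong suc legendre ⟩
  suc m                      ∎)
  where
  open ≡-Reasoning
  lemma : ∀ w v p → w + v + p ≡ v + (p + w)
  lemma = solve-∀

nCk*k!*[n∸k]!≡n! : ∀ {n k} → k ≤ n → (n C k) * (k ! * (n ∸ k) !) ≡ n !
nCk*k!*[n∸k]!≡n! {n} {k} k≤n =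
  trans (cong (_* (k ! * (n ∸ k) !)) (nCk≡n!/k![n-k]! k≤n)) (m/n*n≡m {{k !* (n ∸ k) !≢0}} (k![n∸k]!∣n! k≤n))

[k+1]*nC[k+1]≡[n∸k]*nCk : ∀ {n k} → k < n → suc k * (n C suc k) ≡ (n ∸ k) * (n C k)
[k+1]*nC[k+1]≡[n∸k]*nCk {n} {k} k<n = *-cancelʳ-≡ _ _ (k ! * (n ∸ suc k) !) {{k !* (n ∸ suc k) !≢0}} (begin
  suc k * (n C suc k) * (k ! * (n ∸ suc k) !)        ≡⟨ lemma₁ (suc k) (n C suc k) (k !) ((n ∸ suc k) !) ⟩
  (n C suc k) * (suc k ! * (n ∸ suc k) !)            ≡⟨ nCk*k!*[n∸k]!≡n! k<n ⟩
  n !                                              ≡⟨ nCk*k!*[n∸k]!≡n! (<⇒≤ k<n) ⟨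
  (n C k) * (k ! * (n ∸ k) !)                        ≡⟨ cong (λ x → (n C k) * (k ! * x)) ([n-k]*[n-k-1]!≡[n-k]! k<n) ⟨
  (n C k) * (k ! * ((n ∸ k) * (n ∸ suc k) !))        ≡⟨ lemma₂ (n ∸ k) (n C k) (k !) ((n ∸ suc k) !) ⟩
  (n ∸ k) * (n C k) * (k ! * (n ∸ suc k) !)          ∎)
  where
  open ≡-Reasoning
  lemma₁ : ∀ a c f g → a * c * (f * g) ≡ c * (a * f * g)
  lemma₁ = solve-∀
  lemma₂ : ∀ a c f g → c * (f * (a * g)) ≡ a * c * (f * g)
  lemma₂ = solve-∀

2*n∸n≡n : ∀ n → 2 * n ∸ n ≡ n
2*n∸n≡n n = trans (m+n∸m≡n n (n + 0)) (+-identityʳ n)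

suc-∣-centralBinomial : ∀ n → suc n ∣ (2 * n) C n
suc-∣-centralBinomial zero      = 1∣ 1
suc-∣-centralBinomial n@(suc m) = ∣m+n∣m⇒∣n (subst (suc n ∣_) [n+1]*B≡[n+1]*B′+B (m∣m*n B)) (m∣m*n B′)
  where
  B B′ : ℕ
  B  = (2 * n) C n
  B′ = (2 * n) C suc n
  [n+1]*B≡[n+1]*B′+B : suc n * B ≡ suc n * B′ + B
  [n+1]*B≡[n+1]*B′+B = begin
    B + n * B          ≡⟨ cong (λ x → B + x * B) (2*n∸n≡n n) ⟨
    B + (2 * n ∸ n) * B ≡⟨ cong (B +_) ([k+1]*nC[k+1]≡[n∸k]*nCk (m<m+n n z<s)) ⟨
    B + suc n * B′     ≡⟨ +-comm B (suc n * B′) ⟩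
    suc n * B′ + B     ∎
    where open ≡-Reasoning

catalan-factorials : ∀ n → catalan n * (suc n ! * n !) ≡ (2 * n) !
catalan-factorials n = begin
  catalan n * (suc n * n ! * n !)   ≡⟨ lemma (catalan n) (suc n) (n !) ⟩
  catalan n * suc n * (n ! * n !)   ≡⟨ cong (_* (n ! * n !)) (m/n*n≡m (suc-∣-centralBinomial n)) ⟩
  ((2 * n) C n) * (n ! * n !)           ≡⟨ cong (λ x → ((2 * n) C n) * (n ! * x !)) (2*n∸n≡n n) ⟨
  ((2 * n) C n) * (n ! * (2 * n ∸ n) !) ≡⟨ nCk*k!*[n∸k]!≡n! (m≤m+n n (n + 0)) ⟩
  (2 * n) !                          ∎
  where
  open ≡-Reasoning
  lemma : ∀ c s f → c * (s * f * f) ≡ c * s * (f * f)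
  lemma = solve-∀

catalan≢0 : ∀ n → NonZero (catalan n)
catalan≢0 n = m*n≢0⇒m≢0 (catalan n) {{subst NonZero (sym (catalan-factorials n)) ((2 * n) !≢0)}}

catalan-∥ : ∀ n → ∃ λ v → 2^ v ∥ catalan n × suc v ≡ popcount (suc n)
catalan-∥ n with ∥-exists (catalan n) {{catalan≢0 n}} | factorial-∥ (suc n) | factorial-∥ n | factorial-∥ (2 * n)
... | d , ∥d | b , ∥b , legendre-[n+1] | e , ∥e , legendre-n | a , ∥a , legendre-2n =
  d , ∥d , +-cancelʳ-≡ (b + e + popcount n) (suc d) (popcount (suc n)) (begin
    suc d + (b + e + popcount n)     ≡⟨ lemma₁ d (b + e) (popcount n) ⟩
    suc (d + (b + e) + popcount n)   ≡⟨ cong (λ x → suc (x + popcount n)) d+[b+e]≡a ⟩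
    suc (a + popcount n)             ≡⟨ cong (λ x → suc (a + x)) (popcount-2* n) ⟨
    suc (a + popcount (2 * n))       ≡⟨ cong suc legendre-2n ⟩
    suc (2 * n)                      ≡⟨ lemma₂ n ⟩
    suc n + n                        ≡⟨ cong₂ _+_ legendre-[n+1] legendre-n ⟨
    b + popcount (suc n) + (e + popcount n)   ≡⟨ lemma₃ b (popcount (suc n)) e (popcount n) ⟩
    popcount (suc n) + (b + e + popcount n)   ∎)
  where
  open ≡-Reasoning
  d+[b+e]≡a : d + (b + e) ≡ a
  d+[b+e]≡a = ∥-unique (subst (2^ d + (b + e) ∥_) (catalan-factorials n) (∥-* ∥d (∥-* ∥b ∥e))) ∥a
  lemma₁ : ∀ d x p → suc d + (x + p) ≡ suc (d + x + p)
  lemma₁ = solve-∀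
  lemma₂ : ∀ n → suc (2 * n) ≡ suc n + n
  lemma₂ = solve-∀
  lemma₃ : ∀ b q e p → b + q + (e + p) ≡ q + (b + e + p)
  lemma₃ = solve-∀

2^∣catalan⇔ : ∀ n k → 2 ^ k ∣ catalan n ⇔ suc k ≤ popcount (suc n)
2^∣catalan⇔ n k = from-valuation (catalan-∥ n)
  where
  from-valuation : (∃ λ v → 2^ v ∥ catalan n × suc v ≡ popcount (suc n)) →
                   2 ^ k ∣ catalan n ⇔ suc k ≤ popcount (suc n)
  from-valuation (v , ∥v , suc-v≡popcount) = subst (λ p → 2 ^ k ∣ catalan n ⇔ suc k ≤ p) suc-v≡popcount
    (mk⇔ (s≤s ∘ ∥-∣⇒≤ ∥v) (∥⇒∣ ∥v ∘ ≤-pred))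

∑< : ℕ → (ℕ → ℕ) → ℕ
∑< zero    f = 0
∑< (suc N) f = f 0 + ∑< N (f ∘ suc)

syntax ∑< N (λ i → e) = ∑[ i < N ] e

∑-cong : ∀ N {f g} → (∀ i → f i ≡ g i) → ∑< N f ≡ ∑< N g
∑-cong zero    f≗g = refl
∑-cong (suc N) f≗g = cong₂ _+_ (f≗g 0) (∑-cong N (f≗g ∘ suc))

∑-snoc : ∀ N f → ∑< (suc N) f ≡ ∑< N f + f N
∑-snoc zero    f = +-identityʳ (f 0)
∑-snoc (suc N) f = trans (cong (f 0 +_) (∑-snoc N (f ∘ suc))) (sym (+-assoc (f 0) _ _))

∑-+ : ∀ N f g → ∑[ i < N ] (f i + g i) ≡ ∑< N f + ∑< N g
∑-+ zero    f g = refl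
∑-+ (suc N) f g = trans (cong (f 0 + g 0 +_) (∑-+ N (f ∘ suc) (g ∘ suc))) (interchange (f 0) (g 0) _ _)

∑-2* : ∀ N f → ∑< (2 * N) f ≡ ∑[ i < N ] f (2 * i) + ∑[ i < N ] f (1 + 2 * i)
∑-2* zero    f = refl
∑-2* (suc N) f = begin
  ∑< (2 * suc N) f
    ≡⟨ cong (λ M → ∑< M f) (*-suc 2 N) ⟩
  f 0 + (f 1 + ∑< (2 * N) (f ∘ suc ∘ suc))
    ≡⟨ cong (λ x → f 0 + (f 1 + x)) (∑-2* N (f ∘ suc ∘ suc)) ⟩
  f 0 + (f 1 + (∑[ i < N ] f (2 + 2 * i) + ∑[ i < N ] f (3 + 2 * i)))
    ≡⟨ lemma (f 0) (f 1) _ _ ⟩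
  (f 0 + ∑[ i < N ] f (2 + 2 * i)) + (f 1 + ∑[ i < N ] f (3 + 2 * i))
    ≡⟨ cong₂ (λ x y → (f 0 + x) + (f 1 + y)) (∑-cong N (cong f ∘ *-suc 2)) (∑-cong N (cong (f ∘ suc) ∘ *-suc 2)) ⟨
  ∑[ i < suc N ] f (2 * i) + ∑[ i < suc N ] f (1 + 2 * i) ∎
  where
  open ≡-Reasoning
  lemma : ∀ a b c d → a + (b + (c + d)) ≡ (a + c) + (b + d)
  lemma = solve-∀

∑-shift : ∀ N f → f 0 ≡ 0 → f N ≡ 0 → ∑[ i < N ] f (suc i) ≡ ∑< N f
∑-shift N f f0≡0 fN≡0 = begin
  ∑[ i < N ] f (suc i)   ≡⟨ cong (_+ ∑[ i < N ] f (suc i)) f0≡0 ⟨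
  ∑< (suc N) f           ≡⟨ ∑-snoc N f ⟩
  ∑< N f + f N           ≡⟨ cong (∑< N f +_) fN≡0 ⟩
  ∑< N f + 0             ≡⟨ +-identityʳ _ ⟩
  ∑< N f                 ∎
  where open ≡-Reasoning

indicator : Bool → ℕ
indicator true  = 1
indicator false = 0

length-filter-applyUpTo : ∀ {P : ℕ → Set} (P? : Decidable P) g N →
  length (filter P? (applyUpTo g N)) ≡ ∑[ i < N ] indicator (does (P? (g i)))
length-filter-applyUpTo P? g zero = refl
length-filter-applyUpTo P? g (suc N) with does (P? (g 0))
... | true  = cong suc (length-filter-applyUpTo P? (g ∘ suc) N)
... | false = length-filter-applyUpTo P? (g ∘ suc) N

≤ᵇ-suc : ∀ j i → (suc j ≤ᵇ suc i) ≡ (j ≤ᵇ i)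
≤ᵇ-suc zero    i = refl
≤ᵇ-suc (suc j) i = refl

sum-map-drop-applyUpTo : ∀ (h g : ℕ → ℕ) j N →
  sum (map h (drop j (applyUpTo g N))) ≡ ∑[ i < N ] (indicator (j ≤ᵇ i) * h (g i))
sum-map-drop-applyUpTo h g zero    zero    = refl
sum-map-drop-applyUpTo h g (suc j) zero    = refl
sum-map-drop-applyUpTo h g zero    (suc N) =
  cong₂ _+_ (sym (*-identityˡ (h (g 0)))) (sum-map-drop-applyUpTo h (g ∘ suc) zero N)
sum-map-drop-applyUpTo h g (suc j) (suc N) =
  trans (sum-map-drop-applyUpTo h (g ∘ suc) j N)
        (∑-cong N (λ i → cong (λ b → indicator b * h (g (suc i))) (sym (≤ᵇ-suc j i))))

popcount≥-count : ℕ → ℕ → ℕ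
popcount≥-count t j = ∑[ m < 2 ^ t ] indicator (j ≤ᵇ popcount m)

binomialTail : ℕ → ℕ → ℕ
binomialTail t j = ∑[ i < suc t ] (indicator (j ≤ᵇ i) * (t C i))

popcount≥-count-suc : ∀ t j →
  popcount≥-count (suc t) j ≡ popcount≥-count t j + ∑[ m < 2 ^ t ] indicator (j ≤ᵇ suc (popcount m))
popcount≥-count-suc t j = trans (∑-2* (2 ^ t) count)
  (cong₂ _+_ (∑-cong (2 ^ t) (cong (λ p → indicator (j ≤ᵇ p)) ∘ popcount-2*))
             (∑-cong (2 ^ t) (cong (λ p → indicator (j ≤ᵇ p)) ∘ popcount-1+2*)))
  where
  count : ℕ → ℕ
  count m = indicator (j ≤ᵇ popcount m)

binomialTail-zero : ∀ t → binomialTail t 0 ≡ suc (binomialTail t 1)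
binomialTail-zero t = refl

binomialTail-suc : ∀ t j → binomialTail t (suc j) ≡ ∑[ i < suc t ] (indicator (j ≤ᵇ i) * (t C suc i))
binomialTail-suc t j = begin
  binomialTail t (suc j)
    ≡⟨⟩
  ∑[ i < t ] (indicator (suc j ≤ᵇ suc i) * (t C suc i))
    ≡⟨ ∑-cong t (λ i → cong (λ b → indicator b * (t C suc i)) (≤ᵇ-suc j i)) ⟩
  ∑< t f         ≡⟨ +-identityʳ _ ⟨
  ∑< t f + 0     ≡⟨ cong (∑< t f +_) last-term≡0 ⟨
  ∑< t f + f t   ≡⟨ ∑-snoc t f ⟨
  ∑< (suc t) f   ∎
  where
  open ≡-Reasoning
  f : ℕ → ℕ
  f i = indicator (j ≤ᵇ i) * (t C suc i)
  last-term≡0 : f t ≡ 0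
  last-term≡0 = trans (cong (indicator (j ≤ᵇ t) *_) (k>n⇒nCk≡0 (n<1+n t))) (*-zeroʳ (indicator (j ≤ᵇ t)))

binomialTail-pascal : ∀ t j → binomialTail (suc t) (suc j) ≡ binomialTail t (suc j) + binomialTail t j
binomialTail-pascal t j = begin
  ∑[ i < suc t ] (indicator (suc j ≤ᵇ suc i) * (suc t C suc i))
    ≡⟨ ∑-cong (suc t) pascal ⟩
  ∑[ i < suc t ] (indicator (j ≤ᵇ i) * (t C i) + indicator (j ≤ᵇ i) * (t C suc i))
    ≡⟨ ∑-+ (suc t) (λ i → indicator (j ≤ᵇ i) * (t C i)) (λ i → indicator (j ≤ᵇ i) * (t C suc i)) ⟩
  binomialTail t j + ∑[ i < suc t ] (indicator (j ≤ᵇ i) * (t C suc i))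
    ≡⟨ cong (binomialTail t j +_) (binomialTail-suc t j) ⟨
  binomialTail t j + binomialTail t (suc j)
    ≡⟨ +-comm (binomialTail t j) _ ⟩
  binomialTail t (suc j) + binomialTail t j ∎
  where
  open ≡-Reasoning
  pascal : ∀ i → indicator (suc j ≤ᵇ suc i) * (suc t C suc i)
               ≡ indicator (j ≤ᵇ i) * (t C i) + indicator (j ≤ᵇ i) * (t C suc i)
  pascal i = begin
    indicator (suc j ≤ᵇ suc i) * (suc t C suc i)          ≡⟨ cong (λ b → indicator b * (suc t C suc i)) (≤ᵇ-suc j i) ⟩
    indicator (j ≤ᵇ i) * (suc t C suc i)                  ≡⟨ cong (indicator (j ≤ᵇ i) *_) (nCk+nC[k+1]≡[n+1]C[k+1] t i) ⟨
    indicator (j ≤ᵇ i) * ((t C i) + (t C suc i))          ≡⟨ *-distribˡ-+ (indicator (j ≤ᵇ i)) (t C i) _ ⟩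
    indicator (j ≤ᵇ i) * (t C i) + indicator (j ≤ᵇ i) * (t C suc i) ∎

popcount≥-count≡binomialTail : ∀ t j → popcount≥-count t j ≡ binomialTail t j
popcount≥-count≡binomialTail zero    zero    = refl
popcount≥-count≡binomialTail zero    (suc j) = refl
popcount≥-count≡binomialTail (suc t) zero    = begin
  popcount≥-count (suc t) 0                ≡⟨ popcount≥-count-suc t 0 ⟩
  popcount≥-count t 0 + popcount≥-count t 0 ≡⟨ cong₂ _+_ IH IH ⟩
  binomialTail t 0 + binomialTail t 0       ≡⟨ cong (_+ binomialTail t 0) (binomialTail-zero t) ⟩
  suc (binomialTail t 1 + binomialTail t 0) ≡⟨ cong suc (binomialTail-pascal t 0) ⟨
  suc (binomialTail (suc t) 1)              ≡⟨ binomialTail-zero (suc t) ⟨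
  binomialTail (suc t) 0                    ∎
  where
  open ≡-Reasoning
  IH : popcount≥-count t 0 ≡ binomialTail t 0
  IH = popcount≥-count≡binomialTail t 0
popcount≥-count≡binomialTail (suc t) (suc j) = begin
  popcount≥-count (suc t) (suc j)
    ≡⟨ popcount≥-count-suc t (suc j) ⟩
  popcount≥-count t (suc j) + ∑[ m < 2 ^ t ] indicator (suc j ≤ᵇ suc (popcount m))
    ≡⟨ cong (popcount≥-count t (suc j) +_) (∑-cong (2 ^ t) (cong indicator ∘ ≤ᵇ-suc j ∘ popcount)) ⟩
  popcount≥-count t (suc j) + popcount≥-count t j
    ≡⟨ cong₂ _+_ (popcount≥-count≡binomialTail t (suc j)) (popcount≥-count≡binomialTail t j) ⟩
  binomialTail t (suc j) + binomialTail t j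
    ≡⟨ binomialTail-pascal t j ⟨
  binomialTail (suc t) (suc j) ∎
  where open ≡-Reasoning

corollary3 : (t k : ℕ) → t ≥ 1 → k ≥ 1 → countCatalanDiv t k ≡ binomTailSum t k
corollary3 t k@(suc _) _ _ = begin
  countCatalanDiv t k                   ≡⟨ length-filter-applyUpTo P? id (2 ^ t) ⟩
  ∑[ n < 2 ^ t ] indicator (does (P? n)) ≡⟨ ∑-cong (2 ^ t) P?≡popcount>k ⟩
  ∑[ n < 2 ^ t ] popcount>k (suc n)      ≡⟨ ∑-shift (2 ^ t) popcount>k refl popcount>k-2^t ⟩
  popcount≥-count t (suc k)             ≡⟨ popcount≥-count≡binomialTail t (suc k) ⟩
  binomialTail t (suc k)                ≡⟨ sum-map-drop-applyUpTo (t C_) id (suc k) (suc t) ⟨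
  binomTailSum t k                      ∎
  where
  open ≡-Reasoning
  P? : Decidable (λ n → 1 ≤ n × 2 ^ k ∣ catalan n)
  P? n = (1 ≤? n) ×-dec (2 ^ k ∣? catalan n)
  popcount>k : ℕ → ℕ
  popcount>k m = indicator (suc k ≤ᵇ popcount m)
  popcount>k-2^t : popcount>k (2 ^ t) ≡ 0
  popcount>k-2^t = cong (λ p → indicator (suc k ≤ᵇ p)) (popcount-2^ t)
  P?≡popcount>k : ∀ n → indicator (does (P? n)) ≡ popcount>k (suc n)
  P?≡popcount>k zero    = refl
  P?≡popcount>k (suc n) = cong indicator
    (does-⇔ (2^∣catalan⇔ (suc n) k) (2 ^ k ∣? catalan (suc n)) (suc k ≤? popcount (2 + n)))
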